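{- For every integer $k\geq 1$, \[\sum_{n=1}^\infty\left(\overline{M}_{k-1}(n)-\overline{M}_{k}(n)\right)q^n=2\frac{(-q;q)_k}{(q;q)_{k-1}}\sum_{j=0}^\infty\frac{q^{k(k+j)}(-q^{k+j+1};q)_\infty}{(q^{k+j+1};q)_\infty}.\]
   Context: An overpartition of $n$ is a partition of $n$ in which the last occurrence of each part size may be overlined. Notation: $(a;q)_\infty=\prod_{i\geq 0}(1-aq^i)$, $(a;q)_n=(a;q)_\infty/(aq^n;q)_\infty$. For $k\geq 0$, $\overline{M}_k(n)$ is the number of overpartitions of $n$ in which the smallest part size larger than $k$ occurs at least $k+1$ times (counting overlined and non-overlined occurrences); equivalently, $\sum_{n\geq1}\overline{M}_k(n)q^n=2\frac{(-q;q)_k}{(q;q)_k}\sum_{j=0}^\infty\frac{q^{(k+1)(k+j+1)}(-q^{k+j+2};q)_\infty}{(q^{k+j+1};q)_\infty}$. In particular $\overline{M}_0(n)$ equals the number of overpartitions of $n$ for $n\geq1$. -}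

module Defs where

open import Data.Nat as ℕ using (ℕ; zero; suc; _∸_; _<ᵇ_; _≤ᵇ_)
import Data.Nat.Divisibility as ℕ
open import Data.Integer as ℤ using (ℤ; +_; 0ℤ; 1ℤ)
open import Data.Bool using (Bool; true; false; if_then_else_)
open import Data.Maybe using (Maybe; just; nothing)
open import Data.List using (List; []; _∷_; _++_; map; concatMap; upTo; length; filterᵇ; last; foldr)
open import Data.Product using (_×_; _,_)
open import Relation.Nullary.Decidable using (does)

-- An overpartition is encoded as a list of blocks (s , c , b): part size
-- s ≥ 1 occurring c ≥ 1 times, b = true iff the last occurrence of s is
-- overlined.  Sizes are strictly decreasing along the list.

Block : Set
Block = ℕ × ℕ × Bool

opsBounded : ℕ → ℕ → List (List Block)
opsBounded zero zero    = [] ∷ []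
opsBounded zero (suc n) = []
opsBounded (suc m) n =
  opsBounded m n ++
  concatMap (λ c →
     if (suc c ℕ.* suc m) ≤ᵇ n
     then concatMap (λ b → map ((suc m , suc c , b) ∷_)
                                (opsBounded m (n ∸ (suc c ℕ.* suc m))))
                    (false ∷ true ∷ [])
     else [])
   (upTo n)

overpartitions : ℕ → List (List Block)
overpartitions n = opsBounded n n

blockSize : Block → ℕ
blockSize (s , _ , _) = s

-- "the smallest part size larger than k occurs at least k+1 times"
-- (false if there is no part larger than k).  Since sizes decrease along
-- the list, the smallest size > k is in the last block of size > k.
cond : ℕ → List Block → Bool
cond k xs with last (filterᵇ (λ p → k <ᵇ blockSize p) xs)
... | nothing          = false
... | just (_ , c , _) = k <ᵇ c

Mbar : ℕ → ℕ → ℕ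
Mbar k n = length (filterᵇ (cond k) (overpartitions n))

Series : Set
Series = ℕ → ℤ

sumℤ : List ℤ → ℤ
sumℤ = foldr ℤ._+_ 0ℤ

_⊛_ : Series → Series → Series
(f ⊛ g) n = sumℤ (map (λ i → f i ℤ.* g (n ∸ i)) (upTo (suc n)))

infixl 7 _⊛_

scale : ℤ → Series → Series
scale a f n = a ℤ.* f n

one : Series
one zero    = 1ℤ
one (suc _) = 0ℤ

mono : ℕ → Series
mono a n = if does (a ℕ.≟ n) then 1ℤ else 0ℤ

onePlus : ℕ → Series
onePlus a n = one n ℤ.+ mono a n

-- 1/(1 - q^a) = Σ_t q^{a t}, for a ≥ 1
geomInv : ℕ → Series
geomInv zero    n = 0ℤ       -- never used (a ≥ 1 throughout)
geomInv (suc a) n = if does (suc a ℕ.∣? n) then 1ℤ else 0ℤ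

prodUpTo : ℕ → (ℕ → Series) → Series
prodUpTo zero    f = one
prodUpTo (suc m) f = prodUpTo m f ⊛ f m

-- infinite product ∏_{i≥0} f i, for families with f i ≡ 1 mod q^{i+1}:
-- the coefficient of q^n only depends on the factors i ≤ n.
prodInf : (ℕ → Series) → Series
prodInf f n = prodUpTo (suc n) f n

-- infinite sum Σ_{j≥0} g j, for families where g j ≡ 0 mod q^{j+1}:
-- the coefficient of q^n only depends on the terms j ≤ n.
sumInf : (ℕ → Series) → Series
sumInf g n = sumℤ (map (λ j → g j n) (upTo (suc n)))

-- (-q^a;q)_m = ∏_{i<m} (1 + q^{a+i})
negPoch : ℕ → ℕ → Series
negPoch a m = prodUpTo m (λ i → onePlus (a ℕ.+ i))

-- (-q^a;q)_∞ = ∏_{i≥0} (1 + q^{a+i}), for a ≥ 1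
negPochInf : ℕ → Series
negPochInf a = prodInf (λ i → onePlus (a ℕ.+ i))

-- 1/(q^a;q)_m = ∏_{i<m} 1/(1 - q^{a+i}), for a ≥ 1
invPoch : ℕ → ℕ → Series
invPoch a m = prodUpTo m (λ i → geomInv (a ℕ.+ i))

-- 1/(q^a;q)_∞ = ∏_{i≥0} 1/(1 - q^{a+i}), for a ≥ 1
invPochInf : ℕ → Series
invPochInf a = prodInf (λ i → geomInv (a ℕ.+ i))

rhsCor28 : ℕ → Series
rhsCor28 k =
  scale (+ 2)
    (negPoch 1 k ⊛ invPoch 1 (k ∸ 1) ⊛
     sumInf (λ j → mono (k ℕ.* (k ℕ.+ j)) ⊛
                   negPochInf (k ℕ.+ j ℕ.+ 1) ⊛
                   invPochInf (k ℕ.+ j ℕ.+ 1)))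

-- Let C_K(m) be the generating function of the overpartitions into parts ≤ m counted by M̄_K, and
-- Z_K(m) that of the overpartitions into parts ≤ min(m, K).  Adding c ≥ 1 copies of a new largest part
-- s = m + 1, overlined or not, gives
--   C_K(s) = C_K(m) (1 + q^s)/(1 - q^s) + [K < s] 2 q^{(K+1)s} Z_K(m)/(1 - q^s),
-- since s becomes the smallest part above K exactly when no smaller part exceeds K, and then it has to
-- occur at least K + 1 times.  For K = k - 1 and K = k these recursions give, by induction on m ≥ k,
--   C_{k-1}(m) - C_k(m) = R_m + 2 (-q;q)_{k-1}/(q;q)_{k-1} q^{km}/(1 - q^k),
-- where R_m is the sum of the terms s < m of the right-hand side with their infinite products cut at
-- m; the induction step is an identity between rational functions of q^k and q^{m+1}.  Modulo
-- q^{N+1}, the cut products and sums agree with the infinite ones and q^{km} vanishes once m > N.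

module Submission where

open import Defs
open import Data.Nat as ℕ using (ℕ; zero; suc; _∸_; _≤_; _<_; z≤n; s≤s; _<ᵇ_; _≤ᵇ_)
import Data.Nat.Properties as ℕ
open import Data.Integer as ℤ using (ℤ; +_; 0ℤ; 1ℤ; -_; _+_; _*_; _-_)
import Data.Integer.Properties as ℤ
open import Data.Integer.Tactic.RingSolver using (solve-∀)
open import Data.Bool using (Bool; true; false; if_then_else_; _∧_; _∨_; not)
import Data.Bool.Properties as Bool
open import Data.List using (List; []; _∷_; _++_; map; concatMap; applyUpTo; upTo; filterᵇ; last; null; length)
import Data.List.Properties as List
open import Data.Maybe using (Maybe; just; nothing)
open import Data.Product using (_,_)
open import Data.Sum using (inj₁; inj₂)
open import Data.Nat.Divisibility using (_∣_; _∣?_; _∣0; ∣-refl; ∣⇒≤; ∣m∣n⇒∣m+n; ∣m+n∣m⇒∣n)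
open import Relation.Nullary using (yes; no)
open import Relation.Nullary.Decidable using (dec-true; dec-false; does-⇔)
open import Function using (_∘_; _⇔_; mk⇔)
open import Level using (0ℓ)
open import Algebra.Bundles using (CommutativeRing)
open import Relation.Binary.PropositionalEquality
  using (_≡_; _≗_; refl; sym; trans; cong; cong₂; subst; module ≡-Reasoning)

sumUpTo : ℕ → (ℕ → ℤ) → ℤ
sumUpTo zero    g = 0ℤ
sumUpTo (suc n) g = g 0 + sumUpTo n (g ∘ suc)

sumℤ-applyUpTo : ∀ n (g : ℕ → ℤ) → sumℤ (applyUpTo g n) ≡ sumUpTo n g
sumℤ-applyUpTo zero    g = refl
sumℤ-applyUpTo (suc n) g = cong (λ s → g 0 + s) (sumℤ-applyUpTo n (g ∘ suc))

sumℤ-map-upTo : ∀ n (g : ℕ → ℤ) → sumℤ (map g (upTo n)) ≡ sumUpTo n g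
sumℤ-map-upTo n g = trans (cong sumℤ (List.map-upTo g n)) (sumℤ-applyUpTo n g)

sumUpTo-cong : ∀ n {g h : ℕ → ℤ} → (∀ i → i < n → g i ≡ h i) → sumUpTo n g ≡ sumUpTo n h
sumUpTo-cong zero    eq = refl
sumUpTo-cong (suc n) eq = cong₂ _+_ (eq 0 (s≤s z≤n)) (sumUpTo-cong n (λ i i<n → eq (suc i) (s≤s i<n)))

sumUpTo-zero : ∀ n {g : ℕ → ℤ} → (∀ i → i < n → g i ≡ 0ℤ) → sumUpTo n g ≡ 0ℤ
sumUpTo-zero zero    eq = refl
sumUpTo-zero (suc n) eq =
  trans (cong₂ _+_ (eq 0 (s≤s z≤n)) (sumUpTo-zero n (λ i i<n → eq (suc i) (s≤s i<n)))) (ℤ.+-identityˡ 0ℤ)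

sumUpTo-+ : ∀ n (g h : ℕ → ℤ) → sumUpTo n (λ i → g i + h i) ≡ sumUpTo n g + sumUpTo n h
sumUpTo-+ zero    g h = refl
sumUpTo-+ (suc n) g h = trans (cong (λ s → g 0 + h 0 + s) (sumUpTo-+ n (g ∘ suc) (h ∘ suc)))
                              (interchange (g 0) (h 0) _ _)
  where
  interchange : ∀ a b c d → a + b + (c + d) ≡ a + c + (b + d)
  interchange = solve-∀

sumUpTo-truncate : ∀ m n (g : ℕ → ℤ) → m ≤ n → (∀ i → m ≤ i → g i ≡ 0ℤ) → sumUpTo n g ≡ sumUpTo m g
sumUpTo-truncate zero    n       g _         eq = sumUpTo-zero n (λ i _ → eq i z≤n)
sumUpTo-truncate (suc m) (suc n) g (s≤s m≤n) eq =
  cong (λ s → g 0 + s) (sumUpTo-truncate m n (g ∘ suc) m≤n (λ i m≤i → eq (suc i) (s≤s m≤i)))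

infixl 6 _⊕_
_⊕_ : Series → Series → Series
(f ⊕ g) n = f n + g n

⊖_ : Series → Series
(⊖ f) n = - f n

0ₛ : Series
0ₛ _ = 0ℤ

twice : Series → Series
twice f = f ⊕ f

scale-2 : ∀ f → scale (+ 2) f ≗ twice f
scale-2 f n = twoTimes (f n)
  where
  twoTimes : ∀ z → + 2 * z ≡ z + z
  twoTimes = solve-∀

-- the Cauchy product by recursion on the degree, so that its ring laws can be proved by induction
conv : Series → Series → Series
conv f g zero    = f 0 * g 0
conv f g (suc n) = f 0 * g (suc n) + conv (f ∘ suc) g n

⊛≗conv : ∀ f g → f ⊛ g ≗ conv f g
⊛≗conv f g n = trans (sumℤ-map-upTo (suc n) (λ i → f i * g (n ∸ i))) (go n f)
  where
  go : ∀ n f → sumUpTo (suc n) (λ i → f i * g (n ∸ i)) ≡ conv f g n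
  go zero    f = ℤ.+-identityʳ (f 0 * g 0)
  go (suc n) f = cong (λ s → f 0 * g (suc n) + s) (go n (f ∘ suc))

private
  conv-zeroˡ : ∀ n g → conv (λ _ → 0ℤ) g n ≡ 0ℤ
  conv-zeroˡ zero    g = refl
  conv-zeroˡ (suc n) g = trans (ℤ.+-identityˡ _) (conv-zeroˡ n g)

  conv-identityˡ : ∀ n g → conv one g n ≡ g n
  conv-identityˡ zero    g = ℤ.*-identityˡ (g 0)
  conv-identityˡ (suc n) g =
    trans (cong₂ _+_ (ℤ.*-identityˡ (g (suc n))) (conv-zeroˡ n g)) (ℤ.+-identityʳ (g (suc n)))

  conv-distribʳ : ∀ n f f' g → conv (λ i → f i + f' i) g n ≡ conv f g n + conv f' g n
  conv-distribʳ zero    f f' g = ℤ.*-distribʳ-+ (g 0) (f 0) (f' 0)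
  conv-distribʳ (suc n) f f' g =
    trans (cong (λ s → (f 0 + f' 0) * g (suc n) + s) (conv-distribʳ n (f ∘ suc) (f' ∘ suc) g))
          (rearrange (f 0) (f' 0) (g (suc n)) _ _)
    where
    rearrange : ∀ a b c d e → (a + b) * c + (d + e) ≡ (a * c + d) + (b * c + e)
    rearrange = solve-∀

  conv-distribˡ : ∀ n f g g' → conv f (λ i → g i + g' i) n ≡ conv f g n + conv f g' n
  conv-distribˡ zero    f g g' = ℤ.*-distribˡ-+ (f 0) (g 0) (g' 0)
  conv-distribˡ (suc n) f g g' =
    trans (cong (λ s → f 0 * (g (suc n) + g' (suc n)) + s) (conv-distribˡ n (f ∘ suc) g g'))
          (rearrange (f 0) (g (suc n)) (g' (suc n)) _ _)
    where
    rearrange : ∀ a b c d e → a * (b + c) + (d + e) ≡ (a * b + d) + (a * c + e)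
    rearrange = solve-∀

  conv-scaleˡ : ∀ n c f g → conv (λ i → c * f i) g n ≡ c * conv f g n
  conv-scaleˡ zero    c f g = ℤ.*-assoc c (f 0) (g 0)
  conv-scaleˡ (suc n) c f g =
    trans (cong (λ s → c * f 0 * g (suc n) + s) (conv-scaleˡ n c (f ∘ suc) g))
          (factor c (f 0) (g (suc n)) _)
    where
    factor : ∀ a b c d → a * b * c + a * d ≡ a * (b * c + d)
    factor = solve-∀

  conv-comm : ∀ n f g → conv f g n ≡ conv g f n
  conv-comm zero          f g = ℤ.*-comm (f 0) (g 0)
  conv-comm (suc zero)    f g = swap (f 0) (g 1) (f 1) (g 0)
    where
    swap : ∀ a b c d → a * b + c * d ≡ d * c + b * a
    swap = solve-∀
  conv-comm (suc (suc n)) f g = begin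
    f 0 * g (2 ℕ.+ n) + conv (f ∘ suc) g (suc n)
      ≡⟨ cong (λ s → f 0 * g (2 ℕ.+ n) + s) (conv-comm (suc n) (f ∘ suc) g) ⟩
    f 0 * g (2 ℕ.+ n) + (g 0 * f (2 ℕ.+ n) + conv (g ∘ suc) (f ∘ suc) n)
      ≡⟨ cong (λ s → f 0 * g (2 ℕ.+ n) + (g 0 * f (2 ℕ.+ n) + s)) (conv-comm n (g ∘ suc) (f ∘ suc)) ⟩
    f 0 * g (2 ℕ.+ n) + (g 0 * f (2 ℕ.+ n) + conv (f ∘ suc) (g ∘ suc) n)
      ≡⟨ swap (f 0 * g (2 ℕ.+ n)) (g 0 * f (2 ℕ.+ n)) _ ⟩
    g 0 * f (2 ℕ.+ n) + (f 0 * g (2 ℕ.+ n) + conv (f ∘ suc) (g ∘ suc) n)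
      ≡⟨ cong (λ s → g 0 * f (2 ℕ.+ n) + s) (conv-comm (suc n) (g ∘ suc) f) ⟨
    g 0 * f (2 ℕ.+ n) + conv (g ∘ suc) f (suc n) ∎
    where
    open ≡-Reasoning
    swap : ∀ a b c → a + (b + c) ≡ b + (a + c)
    swap = solve-∀

  conv-assoc : ∀ n f g h → conv (conv f g) h n ≡ conv f (conv g h) n
  conv-assoc zero    f g h = ℤ.*-assoc (f 0) (g 0) (h 0)
  conv-assoc (suc n) f g h =
    trans (cong (λ s → f 0 * g 0 * h (suc n) + s)
            (trans (conv-distribʳ n (λ i → f 0 * g (suc i)) (conv (f ∘ suc) g) h)
                   (cong₂ _+_ (conv-scaleˡ n (f 0) (g ∘ suc) h) (conv-assoc n (f ∘ suc) g h))))
          (factor (f 0) (g 0) (h (suc n)) _ _)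
    where
    factor : ∀ a b c d e → a * b * c + (a * d + e) ≡ a * (b * c + d) + e
    factor = solve-∀

  conv-cong : ∀ n {f f' g g'} → (∀ i → i ≤ n → f i ≡ f' i) → (∀ i → i ≤ n → g i ≡ g' i) →
              conv f g n ≡ conv f' g' n
  conv-cong zero    ef eg = cong₂ _*_ (ef 0 z≤n) (eg 0 z≤n)
  conv-cong (suc n) ef eg =
    cong₂ _+_ (cong₂ _*_ (ef 0 z≤n) (eg (suc n) ℕ.≤-refl))
              (conv-cong n (λ i i≤n → ef (suc i) (s≤s i≤n)) (λ i i≤n → eg i (ℕ.m≤n⇒m≤1+n i≤n)))

infix 4 _≈[_]_
_≈[_]_ : Series → ℕ → Series → Set
f ≈[ N ] g = ∀ i → i ≤ N → f i ≡ g i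

≗⇒≈ : ∀ {f g} N → f ≗ g → f ≈[ N ] g
≗⇒≈ N eq i _ = eq i

⊛-cong-≈ : ∀ N {f f' g g'} → f ≈[ N ] f' → g ≈[ N ] g' → f ⊛ g ≈[ N ] f' ⊛ g'
⊛-cong-≈ N {f} {f'} {g} {g'} ef eg i i≤N = begin
  (f ⊛ g) i     ≡⟨ ⊛≗conv f g i ⟩
  conv f g i    ≡⟨ conv-cong i (λ j j≤i → ef j (ℕ.≤-trans j≤i i≤N)) (λ j j≤i → eg j (ℕ.≤-trans j≤i i≤N)) ⟩
  conv f' g' i  ≡⟨ ⊛≗conv f' g' i ⟨
  (f' ⊛ g') i   ∎
  where open ≡-Reasoning

⊛-vanishes : ∀ n f g → (∀ i → i ≤ n → f i ≡ 0ℤ) → (f ⊛ g) n ≡ 0ℤ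
⊛-vanishes n f g f≈0 = trans (⊛-cong-≈ n {g = g} f≈0 (λ _ _ → refl) n ℕ.≤-refl)
                             (trans (⊛≗conv 0ₛ g n) (conv-zeroˡ n g))

private
  via-conv : ∀ {f g f' g'} → conv f g ≗ conv f' g' → f ⊛ g ≗ f' ⊛ g'
  via-conv {f} {g} {f'} {g'} eq n = trans (⊛≗conv f g n) (trans (eq n) (sym (⊛≗conv f' g' n)))

  ⊛-comm : ∀ f g → f ⊛ g ≗ g ⊛ f
  ⊛-comm f g = via-conv (λ n → conv-comm n f g)

  ⊛-identityˡ : ∀ f → one ⊛ f ≗ f
  ⊛-identityˡ f n = trans (⊛≗conv one f n) (conv-identityˡ n f)

  ⊛-distribʳ : ∀ f g h → (g ⊕ h) ⊛ f ≗ g ⊛ f ⊕ h ⊛ f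
  ⊛-distribʳ f g h n = trans (⊛≗conv (g ⊕ h) f n)
    (trans (conv-distribʳ n g h f) (sym (cong₂ _+_ (⊛≗conv g f n) (⊛≗conv h f n))))

  ⊛-distribˡ : ∀ f g h → f ⊛ (g ⊕ h) ≗ f ⊛ g ⊕ f ⊛ h
  ⊛-distribˡ f g h n = trans (⊛≗conv f (g ⊕ h) n)
    (trans (conv-distribˡ n f g h) (sym (cong₂ _+_ (⊛≗conv f g n) (⊛≗conv f h n))))

  ⊛-assoc : ∀ f g h → f ⊛ g ⊛ h ≗ f ⊛ (g ⊛ h)
  ⊛-assoc f g h n = begin
    (f ⊛ g ⊛ h) n         ≡⟨ ⊛-cong-≈ n {g = h} (λ i _ → ⊛≗conv f g i) (λ _ _ → refl) n ℕ.≤-refl ⟩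
    (conv f g ⊛ h) n      ≡⟨ via-conv (λ m → conv-assoc m f g h) n ⟩
    (f ⊛ conv g h) n      ≡⟨ ⊛-cong-≈ n {f = f} (λ _ _ → refl) (λ i _ → ⊛≗conv g h i) n ℕ.≤-refl ⟨
    (f ⊛ (g ⊛ h)) n       ∎
    where open ≡-Reasoning

seriesRing : ℕ → CommutativeRing 0ℓ 0ℓ
seriesRing N = record
  { Carrier = Series
  ; _≈_ = _≈[ N ]_
  ; _+_ = _⊕_
  ; _*_ = _⊛_
  ; -_ = ⊖_
  ; 0# = 0ₛ
  ; 1# = one
  ; isCommutativeRing = record
    { isRing = record
      { +-isAbelianGroup = record
        { isGroup = record
          { isMonoid = record
            { isSemigroup = record
              { isMagma = record
                { isEquivalence = record
                  { refl = λ _ _ → refl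
                  ; sym = λ e i i≤N → sym (e i i≤N)
                  ; trans = λ e e' i i≤N → trans (e i i≤N) (e' i i≤N) }
                ; ∙-cong = λ e e' i i≤N → cong₂ _+_ (e i i≤N) (e' i i≤N) }
              ; assoc = λ f g h i _ → ℤ.+-assoc (f i) (g i) (h i) }
            ; identity = (λ f i _ → ℤ.+-identityˡ (f i)) , (λ f i _ → ℤ.+-identityʳ (f i)) }
          ; inverse = (λ f i _ → ℤ.+-inverseˡ (f i)) , (λ f i _ → ℤ.+-inverseʳ (f i))
          ; ⁻¹-cong = λ e i i≤N → cong -_ (e i i≤N) }
        ; comm = λ f g i _ → ℤ.+-comm (f i) (g i) }
      ; *-cong = ⊛-cong-≈ N
      ; *-assoc = λ f g h → ≗⇒≈ N (⊛-assoc f g h)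
      ; *-identity = (λ f → ≗⇒≈ N (⊛-identityˡ f))
                   , (λ f → ≗⇒≈ N (λ n → trans (⊛-comm f one n) (⊛-identityˡ f n)))
      ; distrib = (λ f g h → ≗⇒≈ N (⊛-distribˡ f g h)) , (λ f g h → ≗⇒≈ N (⊛-distribʳ f g h)) }
    ; *-comm = λ f g → ≗⇒≈ N (⊛-comm f g) } }

mono-below : ∀ {a n} → n < a → mono a n ≡ 0ℤ
mono-below {suc a} {zero}  _         = refl
mono-below {suc a} {suc n} (s≤s n<a) = mono-below n<a

mono-+ˡ : ∀ a b n → mono (a ℕ.+ b) (a ℕ.+ n) ≡ mono b n
mono-+ˡ zero    b n = refl
mono-+ˡ (suc a) b n = mono-+ˡ a b n

private
  conv-mono-below : ∀ a h {n} → n < a → conv (mono a) h n ≡ 0ℤ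
  conv-mono-below (suc a) h {zero}  _         = ℤ.*-zeroˡ (h 0)
  conv-mono-below (suc a) h {suc n} (s≤s n<a) = trans (ℤ.+-identityˡ _) (conv-mono-below a h n<a)

  conv-mono-+ : ∀ a h n → conv (mono a) h (a ℕ.+ n) ≡ h n
  conv-mono-+ zero    h n = trans (conv-cong n mono0≗one (λ _ _ → refl)) (conv-identityˡ n h)
    where
    mono0≗one : ∀ i → i ≤ n → mono 0 i ≡ one i
    mono0≗one zero    _ = refl
    mono0≗one (suc i) _ = refl
  conv-mono-+ (suc a) h n = trans (ℤ.+-identityˡ _) (conv-mono-+ a h n)

mono-⊛-below : ∀ a h {n} → n < a → (mono a ⊛ h) n ≡ 0ℤ
mono-⊛-below a h {n} n<a = trans (⊛≗conv (mono a) h n) (conv-mono-below a h n<a)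

mono-⊛-+ : ∀ a h n → (mono a ⊛ h) (a ℕ.+ n) ≡ h n
mono-⊛-+ a h n = trans (⊛≗conv (mono a) h (a ℕ.+ n)) (conv-mono-+ a h n)

mono-⊛-unique : ∀ a {g : Series} (h : Series) → (∀ {n} → n < a → g n ≡ 0ℤ) → (∀ n → g (a ℕ.+ n) ≡ h n) →
                g ≗ mono a ⊛ h
mono-⊛-unique a {g} h below above n with n ℕ.<? a
... | yes n<a = trans (below n<a) (sym (mono-⊛-below a h n<a))
... | no  n≮a = subst (λ m → g m ≡ (mono a ⊛ h) m) (ℕ.m+[n∸m]≡n (ℕ.≮⇒≥ n≮a))
                      (trans (above (n ∸ a)) (sym (mono-⊛-+ a h (n ∸ a))))

mono-+ : ∀ a b → mono (a ℕ.+ b) ≗ mono a ⊛ mono b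
mono-+ a b = mono-⊛-unique a {mono (a ℕ.+ b)} (mono b) (λ n<a → mono-below (ℕ.<-≤-trans n<a (ℕ.m≤m+n a b))) (mono-+ˡ a b)

onePlus-below : ∀ {s t} → t < s → onePlus s t ≡ one t
onePlus-below {s} {t} t<s = trans (cong (λ x → one t + x) (mono-below t<s)) (ℤ.+-identityʳ (one t))

geomInv-below : ∀ s {n} → n < suc s → geomInv (suc s) n ≡ one n
geomInv-below s {zero}  _    = cong (λ b → if b then 1ℤ else 0ℤ) (dec-true (suc s ∣? 0) (suc s ∣0))
geomInv-below s {suc n} n<s = cong (λ b → if b then 1ℤ else 0ℤ) (dec-false (suc s ∣? suc n) (λ s∣n → ℕ.<⇒≱ n<s (∣⇒≤ s∣n)))

geomInv-periodic : ∀ s n → geomInv (suc s) (suc s ℕ.+ n) ≡ geomInv (suc s) n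
geomInv-periodic s n = cong (λ b → if b then 1ℤ else 0ℤ) (does-⇔ s∣s+n⇔s∣n (suc s ∣? (suc s ℕ.+ n)) (suc s ∣? n))
  where
  s∣s+n⇔s∣n : suc s ∣ suc s ℕ.+ n ⇔ suc s ∣ n
  s∣s+n⇔s∣n = mk⇔ (λ s∣s+n → ∣m+n∣m⇒∣n s∣s+n ∣-refl) (∣m∣n⇒∣m+n ∣-refl)

geomInv-unfold : ∀ s → geomInv (suc s) ≗ one ⊕ mono (suc s) ⊛ geomInv (suc s)
geomInv-unfold s n with n ℕ.<? suc s
... | yes n<s = trans (geomInv-below s n<s)
                      (sym (trans (cong (λ x → one n + x) (mono-⊛-below (suc s) (geomInv (suc s)) n<s)) (ℤ.+-identityʳ (one n))))
... | no  n≮s = subst (λ m → geomInv (suc s) m ≡ (one ⊕ mono (suc s) ⊛ geomInv (suc s)) m)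
                      (ℕ.m+[n∸m]≡n (ℕ.≮⇒≥ n≮s)) (above (n ∸ suc s))
  where
  above : ∀ m → geomInv (suc s) (suc s ℕ.+ m) ≡ (one ⊕ mono (suc s) ⊛ geomInv (suc s)) (suc s ℕ.+ m)
  above m = trans (geomInv-periodic s m)
                  (sym (trans (ℤ.+-identityˡ _) (mono-⊛-+ (suc s) (geomInv (suc s)) m)))

-- (1 + q^s)/(1 - q^s), the factor of the part size s in the generating function of overpartitions
sizeFactor : ℕ → Series
sizeFactor s = onePlus s ⊛ geomInv s

-- (-q;q)_L/(q;q)_L, the generating function of overpartitions into parts ≤ L
overpartGF : ℕ → Series
overpartGF L = prodUpTo L (sizeFactor ∘ suc)

-- (-q^a;q)_∞/(q^a;q)_∞ = ∏_{s ≥ a} sizeFactor s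
factorsFrom : ℕ → Series
factorsFrom a = negPochInf a ⊛ invPochInf a

sumInf-cong : ∀ {g h : ℕ → Series} → (∀ j → g j ≗ h j) → sumInf g ≗ sumInf h
sumInf-cong {g} {h} eq n = trans (sumℤ-map-upTo (suc n) (λ j → g j n))
  (trans (sumUpTo-cong (suc n) (λ j _ → eq j n)) (sym (sumℤ-map-upTo (suc n) (λ j → h j n))))

sumInf-unfold : ∀ g → (∀ j {n} → n < j → g j n ≡ 0ℤ) → sumInf g ≗ g 0 ⊕ sumInf (g ∘ suc)
sumInf-unfold g vanish n =
  trans (sumℤ-map-upTo (suc n) (λ j → g j n))
        (cong (λ x → g 0 n + x)
              (sym (trans (sumℤ-map-upTo (suc n) (λ j → g (suc j) n))
                          (sumUpTo-truncate n (suc n) (λ j → g (suc j) n) (ℕ.n≤1+n n) (λ j n≤j → vanish (suc j) (s≤s n≤j))))))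

sumInf-vanishes : ∀ g n → (∀ j → g j n ≡ 0ℤ) → sumInf g n ≡ 0ℤ
sumInf-vanishes g n vanish = trans (sumℤ-map-upTo (suc n) (λ j → g j n)) (sumUpTo-zero (suc n) (λ j _ → vanish j))

count : {A : Set} → (A → Bool) → List A → ℤ
count p []       = 0ℤ
count p (x ∷ xs) = (if p x then 1ℤ else 0ℤ) + count p xs

module _ {A : Set} where

  filterᵇ-∷ : ∀ (p : A → Bool) x xs →
              filterᵇ p (x ∷ xs) ≡ (if p x then x ∷ filterᵇ p xs else filterᵇ p xs)
  filterᵇ-∷ p x xs with p x
  ... | true  = refl
  ... | false = refl

  length-filterᵇ : ∀ (p : A → Bool) xs → ℤ.+ length (filterᵇ p xs) ≡ count p xs
  length-filterᵇ p []       = refl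
  length-filterᵇ p (x ∷ xs) rewrite filterᵇ-∷ p x xs with p x
  ... | true  = cong (λ n → 1ℤ + n) (length-filterᵇ p xs)
  ... | false = trans (length-filterᵇ p xs) (sym (ℤ.+-identityˡ _))

  count-cong : ∀ {p q : A → Bool} xs → (∀ x → p x ≡ q x) → count p xs ≡ count q xs
  count-cong []       eq = refl
  count-cong (x ∷ xs) eq = cong₂ (λ b n → (if b then 1ℤ else 0ℤ) + n) (eq x) (count-cong xs eq)

  count-++ : ∀ (p : A → Bool) xs ys → count p (xs ++ ys) ≡ count p xs + count p ys
  count-++ p []       ys = sym (ℤ.+-identityˡ _)
  count-++ p (x ∷ xs) ys = trans (cong (λ n → (if p x then 1ℤ else 0ℤ) + n) (count-++ p xs ys))
                                 (sym (ℤ.+-assoc (if p x then 1ℤ else 0ℤ) (count p xs) (count p ys)))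

  count-concatMap : ∀ {B : Set} (p : A → Bool) (f : B → List A) xs →
                    count p (concatMap f xs) ≡ sumℤ (map (count p ∘ f) xs)
  count-concatMap p f []       = refl
  count-concatMap p f (x ∷ xs) = trans (count-++ p (f x) (concatMap f xs))
                                       (cong (λ n → count p (f x) + n) (count-concatMap p f xs))

  count-map-∷ : ∀ (p : List A → Bool) x ys → count p (map (x ∷_) ys) ≡ count (p ∘ (x ∷_)) ys
  count-map-∷ p x []       = refl
  count-map-∷ p x (y ∷ ys) = cong (λ n → (if p (x ∷ y) then 1ℤ else 0ℤ) + n) (count-map-∷ p x ys)

  count-if : ∀ (p : A → Bool) (t : Bool) xs → count p (if t then xs else []) ≡ (if t then count p xs else 0ℤ)
  count-if p true  xs = refl
  count-if p false xs = refl

  count-false : ∀ (xs : List A) → count (λ _ → false) xs ≡ 0ℤ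
  count-false []       = refl
  count-false (x ∷ xs) = trans (ℤ.+-identityˡ _) (count-false xs)

  count-∧ : ∀ (q : A → Bool) (t : Bool) xs → count (λ x → q x ∧ t) xs ≡ (if t then count q xs else 0ℤ)
  count-∧ q true  xs = count-cong xs (λ x → Bool.∧-identityʳ (q x))
  count-∧ q false xs = trans (count-cong xs (λ x → Bool.∧-zeroʳ (q x))) (count-false xs)

  count-∨ : ∀ (p r : A → Bool) → (∀ x → p x ∧ r x ≡ false) → ∀ xs →
            count (λ x → p x ∨ r x) xs ≡ count p xs + count r xs
  count-∨ p r disjoint []       = refl
  count-∨ p r disjoint (x ∷ xs) with p x | r x | disjoint x
  ... | true  | true  | ()
  ... | true  | false | _ = trans (cong (λ n → 1ℤ + n) (count-∨ p r disjoint xs)) (regroup (count p xs) (count r xs))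
    where
    regroup : ∀ a b → 1ℤ + (a + b) ≡ 1ℤ + a + (0ℤ + b)
    regroup = solve-∀
  ... | false | true  | _ = trans (cong (λ n → 1ℤ + n) (count-∨ p r disjoint xs)) (regroup (count p xs) (count r xs))
    where
    regroup : ∀ a b → 1ℤ + (a + b) ≡ 0ℤ + a + (1ℤ + b)
    regroup = solve-∀
  ... | false | false | _ = trans (cong (λ n → 0ℤ + n) (count-∨ p r disjoint xs)) (regroup (count p xs) (count r xs))
    where
    regroup : ∀ a b → 0ℤ + (a + b) ≡ 0ℤ + a + (0ℤ + b)
    regroup = solve-∀

partsAtMost : ℕ → List Block → Bool
partsAtMost K xs = null (filterᵇ (λ p → K <ᵇ blockSize p) xs)

private
  condOfLast : ℕ → Maybe Block → Bool
  condOfLast K nothing            = false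
  condOfLast K (just (_ , c , _)) = K <ᵇ c

  cond≡condOfLast : ∀ K xs → cond K xs ≡ condOfLast K (last (filterᵇ (λ p → K <ᵇ blockSize p) xs))
  cond≡condOfLast K xs with last (filterᵇ (λ p → K <ᵇ blockSize p) xs)
  ... | nothing = refl
  ... | just _  = refl

  condOfLast-∷ : ∀ K (t : Bool) s c b ys → condOfLast K (last (if t then (s , c , b) ∷ ys else ys)) ≡
                 condOfLast K (last ys) ∨ (null ys ∧ (t ∧ (K <ᵇ c)))
  condOfLast-∷ K false s c b []      = refl
  condOfLast-∷ K false s c b (y ∷ ys) = sym (Bool.∨-identityʳ _)
  condOfLast-∷ K true  s c b []      = refl
  condOfLast-∷ K true  s c b (y ∷ ys) = sym (Bool.∨-identityʳ _)

cond-∷ : ∀ K s c b xs → cond K ((s , c , b) ∷ xs) ≡ cond K xs ∨ (partsAtMost K xs ∧ ((K <ᵇ s) ∧ (K <ᵇ c)))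
cond-∷ K s c b xs = begin
  cond K ((s , c , b) ∷ xs)
    ≡⟨ cond≡condOfLast K ((s , c , b) ∷ xs) ⟩
  condOfLast K (last (filterᵇ big ((s , c , b) ∷ xs)))
    ≡⟨ cong (condOfLast K ∘ last) (filterᵇ-∷ big (s , c , b) xs) ⟩
  condOfLast K (last (if K <ᵇ s then (s , c , b) ∷ filterᵇ big xs else filterᵇ big xs))
    ≡⟨ condOfLast-∷ K (K <ᵇ s) s c b (filterᵇ big xs) ⟩
  condOfLast K (last (filterᵇ big xs)) ∨ (partsAtMost K xs ∧ ((K <ᵇ s) ∧ (K <ᵇ c)))
    ≡⟨ cong (λ x → x ∨ (partsAtMost K xs ∧ ((K <ᵇ s) ∧ (K <ᵇ c)))) (cond≡condOfLast K xs) ⟨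
  cond K xs ∨ (partsAtMost K xs ∧ ((K <ᵇ s) ∧ (K <ᵇ c))) ∎
  where
  open ≡-Reasoning
  big : Block → Bool
  big p = K <ᵇ blockSize p

partsAtMost-∷ : ∀ K s c b xs → partsAtMost K ((s , c , b) ∷ xs) ≡ partsAtMost K xs ∧ not (K <ᵇ s)
partsAtMost-∷ K s c b xs
  rewrite filterᵇ-∷ (λ p → K <ᵇ blockSize p) (s , c , b) xs with K <ᵇ s
... | true  = sym (Bool.∧-zeroʳ _)
... | false = sym (Bool.∧-identityʳ _)

cond∧partsAtMost : ∀ K xs → cond K xs ∧ partsAtMost K xs ≡ false
cond∧partsAtMost K xs rewrite cond≡condOfLast K xs with filterᵇ (λ p → K <ᵇ blockSize p) xs
... | []     = refl
... | _ ∷ _  = Bool.∧-zeroʳ _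

count-cond-∷ : ∀ K s c b xs → count (cond K ∘ ((s , c , b) ∷_)) xs ≡
               count (cond K) xs + (if (K <ᵇ s) ∧ (K <ᵇ c) then count (partsAtMost K) xs else 0ℤ)
count-cond-∷ K s c b xs = begin
  count (cond K ∘ ((s , c , b) ∷_)) xs
    ≡⟨ count-cong xs (cond-∷ K s c b) ⟩
  count (λ ys → cond K ys ∨ (partsAtMost K ys ∧ ((K <ᵇ s) ∧ (K <ᵇ c)))) xs
    ≡⟨ count-∨ (cond K) _ disjoint xs ⟩
  count (cond K) xs + count (λ ys → partsAtMost K ys ∧ ((K <ᵇ s) ∧ (K <ᵇ c))) xs
    ≡⟨ cong (λ n → count (cond K) xs + n) (count-∧ (partsAtMost K) ((K <ᵇ s) ∧ (K <ᵇ c)) xs) ⟩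
  count (cond K) xs + (if (K <ᵇ s) ∧ (K <ᵇ c) then count (partsAtMost K) xs else 0ℤ) ∎
  where
  open ≡-Reasoning
  disjoint : ∀ ys → cond K ys ∧ (partsAtMost K ys ∧ ((K <ᵇ s) ∧ (K <ᵇ c))) ≡ false
  disjoint ys = trans (sym (Bool.∧-assoc (cond K ys) _ _)) (cong (_∧ ((K <ᵇ s) ∧ (K <ᵇ c))) (cond∧partsAtMost K ys))

count-partsAtMost-∷ : ∀ K s c b xs → count (partsAtMost K ∘ ((s , c , b) ∷_)) xs ≡
                      (if not (K <ᵇ s) then count (partsAtMost K) xs else 0ℤ)
count-partsAtMost-∷ K s c b xs =
  trans (count-cong xs (partsAtMost-∷ K s c b)) (count-∧ (partsAtMost K) (not (K <ᵇ s)) xs)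

-- Σ_{c ≥ 0} q^{(c+1)s} F c: c + 1 copies of the part s, followed by a remainder counted by F c
blockSum : ℕ → (ℕ → Series) → Series
blockSum s F n = sumUpTo n (λ c → if suc c ℕ.* s ≤ᵇ n then F c (n ∸ suc c ℕ.* s) else 0ℤ)

private
  withLargest : ℕ → ℕ → ℕ → List (List Block)
  withLargest m n c =
    if suc c ℕ.* suc m ≤ᵇ n
    then concatMap (λ b → map ((suc m , suc c , b) ∷_) (opsBounded m (n ∸ suc c ℕ.* suc m))) (false ∷ true ∷ [])
    else []

count-opsBounded-suc : ∀ (P : List Block → Bool) m n →
  count P (opsBounded (suc m) n) ≡
  count P (opsBounded m n) +
  blockSum (suc m) (λ c r → count (P ∘ ((suc m , suc c , false) ∷_)) (opsBounded m r) +
                            (count (P ∘ ((suc m , suc c , true) ∷_)) (opsBounded m r) + 0ℤ)) n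
count-opsBounded-suc P m n =
  trans (count-++ P (opsBounded m n) (concatMap (withLargest m n) (upTo n)))
        (cong (λ x → count P (opsBounded m n) + x)
              (trans (count-concatMap P (withLargest m n) (upTo n))
                     (trans (sumℤ-map-upTo n (count P ∘ withLargest m n)) (sumUpTo-cong n (λ c _ → largest c)))))
  where
  S = suc m
  largest : ∀ c → count P (withLargest m n c) ≡
    (if suc c ℕ.* S ≤ᵇ n
     then count (P ∘ ((S , suc c , false) ∷_)) (opsBounded m (n ∸ suc c ℕ.* S)) +
          (count (P ∘ ((S , suc c , true) ∷_)) (opsBounded m (n ∸ suc c ℕ.* S)) + 0ℤ)
     else 0ℤ)
  largest c =
    trans (count-if P (suc c ℕ.* S ≤ᵇ n) _)
          (cong (λ x → if suc c ℕ.* S ≤ᵇ n then x else 0ℤ)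
                (trans (count-concatMap P (λ b → map ((S , suc c , b) ∷_) (opsBounded m (n ∸ suc c ℕ.* S))) (false ∷ true ∷ []))
                       (cong₂ (λ x y → x + (y + 0ℤ)) (count-map-∷ P (S , suc c , false) (opsBounded m (n ∸ suc c ℕ.* S)))
                                                     (count-map-∷ P (S , suc c , true) (opsBounded m (n ∸ suc c ℕ.* S))))))

opsBounded-beyond : ∀ m n → n ≤ m → opsBounded (suc m) n ≡ opsBounded m n
opsBounded-beyond m n n≤m =
  trans (cong (opsBounded m n ++_) (concatMap-[] (upTo n))) (List.++-identityʳ (opsBounded m n))
  where
  tooLarge : ∀ c → (suc c ℕ.* suc m ≤ᵇ n) ≡ false
  tooLarge c = dec-false (suc c ℕ.* suc m ℕ.≤? n)
                         (λ le → ℕ.<⇒≱ (s≤s n≤m) (ℕ.≤-trans (ℕ.m≤m+n (suc m) (c ℕ.* suc m)) le))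
  concatMap-[] : ∀ cs → concatMap (withLargest m n) cs ≡ []
  concatMap-[] []       = refl
  concatMap-[] (c ∷ cs) rewrite tooLarge c = concatMap-[] cs

opsBounded-stable : ∀ d n → opsBounded (d ℕ.+ n) n ≡ overpartitions n
opsBounded-stable zero    n = refl
opsBounded-stable (suc d) n = trans (opsBounded-beyond (d ℕ.+ n) n (ℕ.m≤n+m n d)) (opsBounded-stable d n)

blockSum-cong : ∀ s {F G : ℕ → Series} → (∀ c → F c ≗ G c) → blockSum s F ≗ blockSum s G
blockSum-cong s eq n = sumUpTo-cong n (λ c _ → cong (λ x → if suc c ℕ.* s ≤ᵇ n then x else 0ℤ) (eq c _))

blockSum-⊕ : ∀ s (F G : ℕ → Series) → blockSum s (λ c → F c ⊕ G c) ≗ blockSum s F ⊕ blockSum s G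
blockSum-⊕ s F G n = trans (sumUpTo-cong n (λ c _ → if-+ (suc c ℕ.* s ≤ᵇ n))) (sumUpTo-+ n _ _)
  where
  if-+ : ∀ (b : Bool) {x y} → (if b then x + y else 0ℤ) ≡ (if b then x else 0ℤ) + (if b then y else 0ℤ)
  if-+ true  = refl
  if-+ false = refl

blockSum-0ₛ : ∀ s → blockSum s (λ _ → 0ₛ) ≗ 0ₛ
blockSum-0ₛ s n = sumUpTo-zero n (λ c _ → if-0 (suc c ℕ.* s ≤ᵇ n))
  where
  if-0 : ∀ (b : Bool) → (if b then 0ℤ else 0ℤ) ≡ 0ℤ
  if-0 true  = refl
  if-0 false = refl

blockSum-unfold : ∀ s F → blockSum (suc s) F ≗ mono (suc s) ⊛ (F 0 ⊕ blockSum (suc s) (F ∘ suc))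
blockSum-unfold s F = mono-⊛-unique S (F 0 ⊕ blockSum S (F ∘ suc)) below above
  where
  S = suc s
  multipleTooLarge : ∀ {c r} → r < suc c ℕ.* S → (suc c ℕ.* S ≤ᵇ r) ≡ false
  multipleTooLarge {c} {r} r<cS = dec-false (suc c ℕ.* S ℕ.≤? r) (ℕ.<⇒≱ r<cS)
  below : ∀ {n} → n < S → blockSum S F n ≡ 0ℤ
  below {n} n<S = sumUpTo-zero n (λ c _ →
    cong (λ b → if b then F c (n ∸ suc c ℕ.* S) else 0ℤ)
         (multipleTooLarge {c} (ℕ.<-≤-trans n<S (ℕ.m≤m+n S (c ℕ.* S)))))
  first : ∀ n → (if 1 ℕ.* S ≤ᵇ S ℕ.+ n then F 0 (S ℕ.+ n ∸ 1 ℕ.* S) else 0ℤ) ≡ F 0 n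
  first n = trans (cong (λ k → if k ≤ᵇ S ℕ.+ n then F 0 (S ℕ.+ n ∸ k) else 0ℤ) (ℕ.*-identityˡ S))
                  (cong₂ (λ b r → if b then F 0 r else 0ℤ) (dec-true (S ℕ.≤? S ℕ.+ n) (ℕ.m≤m+n S n)) (ℕ.m+n∸m≡n S n))
  shifted : ∀ n c → (if suc (suc c) ℕ.* S ≤ᵇ S ℕ.+ n then F (suc c) (S ℕ.+ n ∸ suc (suc c) ℕ.* S) else 0ℤ) ≡
                    (if suc c ℕ.* S ≤ᵇ n then F (suc c) (n ∸ suc c ℕ.* S) else 0ℤ)
  shifted n c rewrite ℕ.[m+n]∸[m+o]≡n∸o S n (suc c ℕ.* S) =
    cong (λ b → if b then F (suc c) (n ∸ suc c ℕ.* S) else 0ℤ)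
         (does-⇔ (mk⇔ (ℕ.+-cancelˡ-≤ S (suc c ℕ.* S) n) (ℕ.+-monoʳ-≤ S)) (S ℕ.+ suc c ℕ.* S ℕ.≤? S ℕ.+ n) (suc c ℕ.* S ℕ.≤? n))
  above : ∀ n → blockSum S F (S ℕ.+ n) ≡ F 0 n + blockSum S (F ∘ suc) n
  above n = cong₂ _+_ (first n)
    (trans (sumUpTo-cong (s ℕ.+ n) (λ c _ → shifted n c))
           (sumUpTo-truncate n (s ℕ.+ n) _ (ℕ.m≤n+m n s)
              (λ c n≤c → cong (λ b → if b then F (suc c) (n ∸ suc c ℕ.* S) else 0ℤ)
                              (multipleTooLarge {c} (s≤s (ℕ.≤-trans n≤c (ℕ.≤-trans (ℕ.m≤m*n c S) (ℕ.m≤n+m (c ℕ.* S) s))))))))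

-- the series C_K(m) and Z_K(m)
condGF : ℕ → ℕ → Series
condGF K m n = count (cond K) (opsBounded m n)

atMostGF : ℕ → ℕ → Series
atMostGF K m n = count (partsAtMost K) (opsBounded m n)

condGF-suc : ∀ K m → condGF K (suc m) ≗
  condGF K m ⊕ blockSum (suc m) (λ c → twice (condGF K m) ⊕
                                      (if (K <ᵇ suc m) ∧ (K <ᵇ suc c) then twice (atMostGF K m) else 0ₛ))
condGF-suc K m n =
  trans (count-opsBounded-suc (cond K) m n)
        (cong (λ x → condGF K m n + x)
              (blockSum-cong (suc m) (λ c r → trans (cong₂ (λ x y → x + (y + 0ℤ)) (count-cond-∷ K (suc m) (suc c) false (opsBounded m r))
                                                                                  (count-cond-∷ K (suc m) (suc c) true (opsBounded m r)))
                                                     (doubled ((K <ᵇ suc m) ∧ (K <ᵇ suc c)) (condGF K m) (atMostGF K m) r)) n))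
  where
  doubled : ∀ t (A Z : Series) r → (A r + (if t then Z r else 0ℤ)) + ((A r + (if t then Z r else 0ℤ)) + 0ℤ) ≡
                                  (twice A ⊕ (if t then twice Z else 0ₛ)) r
  doubled true  A Z r = regroup (A r) (Z r)
    where
    regroup : ∀ a z → (a + z) + ((a + z) + 0ℤ) ≡ a + a + (z + z)
    regroup = solve-∀
  doubled false A Z r = regroup (A r)
    where
    regroup : ∀ a → (a + 0ℤ) + ((a + 0ℤ) + 0ℤ) ≡ a + a + 0ℤ
    regroup = solve-∀

atMostGF-suc : ∀ K m → atMostGF K (suc m) ≗
  atMostGF K m ⊕ blockSum (suc m) (λ _ → if not (K <ᵇ suc m) then twice (atMostGF K m) else 0ₛ)
atMostGF-suc K m n =
  trans (count-opsBounded-suc (partsAtMost K) m n)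
        (cong (λ x → atMostGF K m n + x)
              (blockSum-cong (suc m) (λ c r → trans (cong₂ (λ x y → x + (y + 0ℤ)) (count-partsAtMost-∷ K (suc m) (suc c) false (opsBounded m r))
                                                                                  (count-partsAtMost-∷ K (suc m) (suc c) true (opsBounded m r)))
                                                     (doubled (not (K <ᵇ suc m)) (atMostGF K m) r)) n))
  where
  doubled : ∀ t (Z : Series) r → (if t then Z r else 0ℤ) + ((if t then Z r else 0ℤ) + 0ℤ) ≡ (if t then twice Z else 0ₛ) r
  doubled true  Z r = cong (λ x → Z r + x) (ℤ.+-identityʳ (Z r))
  doubled false Z r = refl

Mbar≡condGF : ∀ K m n → n ≤ m → ℤ.+ Mbar K n ≡ condGF K m n
Mbar≡condGF K m n n≤m =
  trans (length-filterᵇ (cond K) (overpartitions n))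
        (cong (count (cond K)) (sym (trans (cong (λ m → opsBounded m n) (sym (ℕ.m∸n+n≡m n≤m))) (opsBounded-stable (m ∸ n) n))))

module Truncated (N : ℕ) where

  open CommutativeRing (seriesRing N) public
    using (_≈_; setoid; +-cong; *-cong; *-assoc; +-identityˡ; +-identityʳ; *-identityˡ; *-identityʳ; zeroˡ)
    renaming (refl to ≈-refl; sym to ≈-sym; trans to ≈-trans; reflexive to ≈-reflexive)
  open import Relation.Binary.Reasoning.Setoid setoid public
  open import Algebra.Solver.Ring.NaturalCoefficients.Default (CommutativeRing.commutativeSemiring (seriesRing N)) public
    using (solve; _:=_; _:+_; _:*_; con)
  open import Algebra.Properties.Group (CommutativeRing.+-group (seriesRing N)) using (∙-cancelʳ)

  ⊕-cancelʳ : ∀ w {l r} → l ⊕ w ≈ r ⊕ w → l ≈ r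
  ⊕-cancelʳ w = ∙-cancelʳ w _ _

  twice-cong : ∀ {f g} → f ≈ g → twice f ≈ twice g
  twice-cong f≈g = +-cong f≈g f≈g

  geomInv-unfold-≈ : ∀ s → geomInv (suc s) ≈ one ⊕ mono (suc s) ⊛ geomInv (suc s)
  geomInv-unfold-≈ s = ≗⇒≈ N (geomInv-unfold s)

  mono-+-≈ : ∀ a b → mono (a ℕ.+ b) ≈ mono a ⊛ mono b
  mono-+-≈ a b = ≗⇒≈ N (mono-+ a b)

  mono-beyond : ∀ {a} → N < a → mono a ≈ 0ₛ
  mono-beyond N<a i i≤N = mono-below (ℕ.≤-<-trans i≤N N<a)

  absorbBlocks : ∀ s C → C ⊕ mono (suc s) ⊛ twice C ⊛ geomInv (suc s) ≈ C ⊛ sizeFactor (suc s)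
  absorbBlocks s C = begin
    C ⊕ y ⊛ twice C ⊛ v         ≈⟨ solve 3 (λ C y v → C :+ y :* (C :+ C) :* v := C :* (con 1 :+ y :* v) :+ C :* y :* v) ≈-refl C y v ⟩
    C ⊛ (one ⊕ y ⊛ v) ⊕ C ⊛ y ⊛ v ≈⟨ +-cong (*-cong (≈-refl {C}) (≈-sym (geomInv-unfold-≈ s))) ≈-refl ⟩
    C ⊛ v ⊕ C ⊛ y ⊛ v           ≈⟨ solve 3 (λ C y v → C :* v :+ C :* y :* v := C :* ((con 1 :+ y) :* v)) ≈-refl C y v ⟩
    C ⊛ sizeFactor (suc s)      ∎
    where
    y = mono (suc s)
    v = geomInv (suc s)

  blockSum-const : ∀ s f → blockSum (suc s) (λ _ → f) ≈ mono (suc s) ⊛ f ⊛ geomInv (suc s)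
  blockSum-const s f = ⊕-cancelʳ (y ⊛ B ⊛ v) (begin
    B ⊕ y ⊛ B ⊛ v           ≈⟨ solve 3 (λ B y v → B :+ y :* B :* v := B :* (con 1 :+ y :* v)) ≈-refl B y v ⟩
    B ⊛ (one ⊕ y ⊛ v)       ≈⟨ *-cong (≈-refl {B}) (≈-sym (geomInv-unfold-≈ s)) ⟩
    B ⊛ v                   ≈⟨ *-cong (≗⇒≈ N (blockSum-unfold s (λ _ → f))) (≈-refl {v}) ⟩
    y ⊛ (f ⊕ B) ⊛ v         ≈⟨ solve 4 (λ B f y v → y :* (f :+ B) :* v := y :* f :* v :+ y :* B :* v) ≈-refl B f y v ⟩
    y ⊛ f ⊛ v ⊕ y ⊛ B ⊛ v   ∎)
    where
    B = blockSum (suc s) (λ _ → f)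
    y = mono (suc s)
    v = geomInv (suc s)

  blockSum-from : ∀ s K f → blockSum (suc s) (λ c → if K <ᵇ suc c then f else 0ₛ) ≈ mono (suc K ℕ.* suc s) ⊛ f ⊛ geomInv (suc s)
  blockSum-from s zero    f =
    ≈-trans (blockSum-const s f) (≈-reflexive (cong (λ e → mono e ⊛ f ⊛ geomInv (suc s)) (sym (ℕ.*-identityˡ (suc s)))))
  blockSum-from s (suc K) f = begin
    blockSum S (λ c → if suc K <ᵇ suc c then f else 0ₛ)
      ≈⟨ ≗⇒≈ N (blockSum-unfold s (λ c → if suc K <ᵇ suc c then f else 0ₛ)) ⟩
    mono S ⊛ (0ₛ ⊕ blockSum S (λ c → if K <ᵇ suc c then f else 0ₛ))
      ≈⟨ *-cong (≈-refl {mono S}) (≈-trans (+-identityˡ _) (blockSum-from s K f)) ⟩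
    mono S ⊛ (mono (suc K ℕ.* S) ⊛ f ⊛ geomInv S)
      ≈⟨ solve 4 (λ a b f v → a :* (b :* f :* v) := a :* b :* f :* v) ≈-refl (mono S) (mono (suc K ℕ.* S)) f (geomInv S) ⟩
    mono S ⊛ mono (suc K ℕ.* S) ⊛ f ⊛ geomInv S
      ≈⟨ *-cong (*-cong (≈-sym (mono-+-≈ S (suc K ℕ.* S))) (≈-refl {f})) (≈-refl {geomInv S}) ⟩
    mono (suc (suc K) ℕ.* S) ⊛ f ⊛ geomInv S ∎
    where
    S = suc s

  private
    K<ᵇs : ∀ {K s} → K < s → (K <ᵇ s) ≡ true
    K<ᵇs {K} {s} K<s = dec-true (K ℕ.<? s) K<s

    s≤ᵇK : ∀ {K s} → s ≤ K → (K <ᵇ s) ≡ false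
    s≤ᵇK {K} {s} s≤K = dec-false (K ℕ.<? s) (ℕ.≤⇒≯ s≤K)

  condGF-suc-above : ∀ K m → K < suc m →
    condGF K (suc m) ≈ condGF K m ⊛ sizeFactor (suc m) ⊕ mono (suc K ℕ.* suc m) ⊛ twice (atMostGF K m) ⊛ geomInv (suc m)
  condGF-suc-above K m K<s = begin
    condGF K (suc m)
      ≈⟨ ≗⇒≈ N (condGF-suc K m) ⟩
    C ⊕ blockSum S (λ c → twice C ⊕ (if (K <ᵇ S) ∧ (K <ᵇ suc c) then twice Z else 0ₛ))
      ≈⟨ ≈-reflexive (cong (λ t → C ⊕ blockSum S (λ c → twice C ⊕ (if t ∧ (K <ᵇ suc c) then twice Z else 0ₛ))) (K<ᵇs K<s)) ⟩
    C ⊕ blockSum S (λ c → twice C ⊕ (if K <ᵇ suc c then twice Z else 0ₛ))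
      ≈⟨ +-cong (≈-refl {C}) (≗⇒≈ N (blockSum-⊕ S (λ _ → twice C) (λ c → if K <ᵇ suc c then twice Z else 0ₛ))) ⟩
    C ⊕ (blockSum S (λ _ → twice C) ⊕ blockSum S (λ c → if K <ᵇ suc c then twice Z else 0ₛ))
      ≈⟨ +-cong (≈-refl {C}) (+-cong (blockSum-const m (twice C)) (blockSum-from m K (twice Z))) ⟩
    C ⊕ (mono S ⊛ twice C ⊛ geomInv S ⊕ mono (suc K ℕ.* S) ⊛ twice Z ⊛ geomInv S)
      ≈⟨ solve 3 (λ a b c → a :+ (b :+ c) := a :+ b :+ c) ≈-refl C _ _ ⟩
    C ⊕ mono S ⊛ twice C ⊛ geomInv S ⊕ mono (suc K ℕ.* S) ⊛ twice Z ⊛ geomInv S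
      ≈⟨ +-cong (absorbBlocks m C) ≈-refl ⟩
    C ⊛ sizeFactor S ⊕ mono (suc K ℕ.* S) ⊛ twice Z ⊛ geomInv S ∎
    where
    S = suc m
    C = condGF K m
    Z = atMostGF K m

  condGF-suc-below : ∀ K m → suc m ≤ K → condGF K (suc m) ≈ condGF K m ⊛ sizeFactor (suc m)
  condGF-suc-below K m s≤K = begin
    condGF K (suc m)
      ≈⟨ ≗⇒≈ N (condGF-suc K m) ⟩
    C ⊕ blockSum S (λ c → twice C ⊕ (if (K <ᵇ S) ∧ (K <ᵇ suc c) then twice Z else 0ₛ))
      ≈⟨ ≈-reflexive (cong (λ t → C ⊕ blockSum S (λ c → twice C ⊕ (if t ∧ (K <ᵇ suc c) then twice Z else 0ₛ))) (s≤ᵇK s≤K)) ⟩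
    C ⊕ blockSum S (λ _ → twice C ⊕ 0ₛ)
      ≈⟨ +-cong (≈-refl {C}) (≗⇒≈ N (blockSum-cong S (λ _ r → ℤ.+-identityʳ (twice C r)))) ⟩
    C ⊕ blockSum S (λ _ → twice C)
      ≈⟨ +-cong (≈-refl {C}) (blockSum-const m (twice C)) ⟩
    C ⊕ mono S ⊛ twice C ⊛ geomInv S
      ≈⟨ absorbBlocks m C ⟩
    C ⊛ sizeFactor S ∎
    where
    S = suc m
    C = condGF K m
    Z = atMostGF K m

  atMostGF-suc-above : ∀ K m → K < suc m → atMostGF K (suc m) ≈ atMostGF K m
  atMostGF-suc-above K m K<s = begin
    atMostGF K (suc m)
      ≈⟨ ≗⇒≈ N (atMostGF-suc K m) ⟩
    Z ⊕ blockSum S (λ _ → if not (K <ᵇ S) then twice Z else 0ₛ)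
      ≈⟨ ≈-reflexive (cong (λ t → Z ⊕ blockSum S (λ _ → if not t then twice Z else 0ₛ)) (K<ᵇs K<s)) ⟩
    Z ⊕ blockSum S (λ _ → 0ₛ)
      ≈⟨ +-cong (≈-refl {Z}) (λ i _ → blockSum-0ₛ S i) ⟩
    Z ⊕ 0ₛ
      ≈⟨ +-identityʳ Z ⟩
    Z ∎
    where
    S = suc m
    Z = atMostGF K m

  atMostGF-suc-below : ∀ K m → suc m ≤ K → atMostGF K (suc m) ≈ atMostGF K m ⊛ sizeFactor (suc m)
  atMostGF-suc-below K m s≤K = begin
    atMostGF K (suc m)
      ≈⟨ ≗⇒≈ N (atMostGF-suc K m) ⟩
    Z ⊕ blockSum S (λ _ → if not (K <ᵇ S) then twice Z else 0ₛ)
      ≈⟨ ≈-reflexive (cong (λ t → Z ⊕ blockSum S (λ _ → if not t then twice Z else 0ₛ)) (s≤ᵇK s≤K)) ⟩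
    Z ⊕ blockSum S (λ _ → twice Z)
      ≈⟨ +-cong (≈-refl {Z}) (blockSum-const m (twice Z)) ⟩
    Z ⊕ mono S ⊛ twice Z ⊛ geomInv S
      ≈⟨ absorbBlocks m Z ⟩
    Z ⊛ sizeFactor S ∎
    where
    S = suc m
    Z = atMostGF K m

  condGF-small : ∀ K m → m ≤ K → condGF K m ≈ 0ₛ
  condGF-small K zero    _   zero    _ = refl
  condGF-small K zero    _   (suc i) _ = refl
  condGF-small K (suc m) s≤K =
    ≈-trans (condGF-suc-below K m s≤K) (≈-trans (*-cong (condGF-small K m (ℕ.<⇒≤ s≤K)) ≈-refl) (zeroˡ (sizeFactor (suc m))))

  atMostGF-small : ∀ K m → m ≤ K → atMostGF K m ≈ overpartGF m
  atMostGF-small K zero    _   zero    _ = refl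
  atMostGF-small K zero    _   (suc i) _ = refl
  atMostGF-small K (suc m) s≤K =
    ≈-trans (atMostGF-suc-below K m s≤K) (*-cong (atMostGF-small K m (ℕ.<⇒≤ s≤K)) ≈-refl)

  atMostGF-large : ∀ K m → K ≤ m → atMostGF K m ≈ overpartGF K
  atMostGF-large K m K≤m = subst (λ m → atMostGF K m ≈ overpartGF K) (ℕ.m∸n+n≡m K≤m) (beyond (m ∸ K))
    where
    beyond : ∀ d → atMostGF K (d ℕ.+ K) ≈ overpartGF K
    beyond zero    = atMostGF-small K K ℕ.≤-refl
    beyond (suc d) = ≈-trans (atMostGF-suc-above K (d ℕ.+ K) (s≤s (ℕ.m≤n+m K d))) (beyond d)

  prodUpTo-cong : ∀ L {f g : ℕ → Series} → (∀ i → f i ≈ g i) → prodUpTo L f ≈ prodUpTo L g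
  prodUpTo-cong zero    eq = ≈-refl
  prodUpTo-cong (suc L) eq = *-cong (prodUpTo-cong L eq) (eq L)

  prodUpTo-one : ∀ L {f : ℕ → Series} → (∀ i → f i ≈ one) → prodUpTo L f ≈ one
  prodUpTo-one zero    eq = ≈-refl
  prodUpTo-one (suc L) eq = ≈-trans (*-cong (prodUpTo-one L eq) (eq L)) (*-identityʳ one)

  prodUpTo-unfoldˡ : ∀ L f → prodUpTo (suc L) f ≈ f 0 ⊛ prodUpTo L (f ∘ suc)
  prodUpTo-unfoldˡ zero    f = ≈-trans (*-identityˡ (f 0)) (≈-sym (*-identityʳ (f 0)))
  prodUpTo-unfoldˡ (suc L) f = begin
    prodUpTo (suc L) f ⊛ f (suc L)              ≈⟨ *-cong (prodUpTo-unfoldˡ L f) ≈-refl ⟩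
    f 0 ⊛ prodUpTo L (f ∘ suc) ⊛ f (suc L)     ≈⟨ solve 3 (λ a b c → a :* b :* c := a :* (b :* c)) ≈-refl (f 0) _ _ ⟩
    f 0 ⊛ prodUpTo (suc L) (f ∘ suc)           ∎

  prodUpTo-⊛ : ∀ L f g → prodUpTo L f ⊛ prodUpTo L g ≈ prodUpTo L (λ i → f i ⊛ g i)
  prodUpTo-⊛ zero    f g = *-identityˡ one
  prodUpTo-⊛ (suc L) f g = begin
    prodUpTo L f ⊛ f L ⊛ (prodUpTo L g ⊛ g L)
      ≈⟨ solve 4 (λ a b c d → a :* b :* (c :* d) := a :* c :* (b :* d)) ≈-refl (prodUpTo L f) (f L) (prodUpTo L g) (g L) ⟩
    prodUpTo L f ⊛ prodUpTo L g ⊛ (f L ⊛ g L)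
      ≈⟨ *-cong (prodUpTo-⊛ L f g) ≈-refl ⟩
    prodUpTo L (λ i → f i ⊛ g i) ⊛ (f L ⊛ g L) ∎

  prodInf-≈ : ∀ f → (∀ j t → t ≤ j → f j t ≡ one t) → prodInf f ≈ prodUpTo (suc N) f
  prodInf-≈ f nearOne t t≤N = sym (stable (suc N) (s≤s t≤N))
    where
    stable : ∀ L → t < L → prodUpTo L f t ≡ prodUpTo (suc t) f t
    stable (suc L) (s≤s t≤L) with ℕ.m≤n⇒m<n∨m≡n t≤L
    ... | inj₂ refl = refl
    ... | inj₁ t<L  = trans (times-one (prodUpTo L f)) (stable L t<L)
      where
      times-one : ∀ h → (h ⊛ f L) t ≡ h t
      times-one h = trans (⊛-cong-≈ t {h} (λ _ _ → refl) (λ i i≤t → nearOne L i (ℕ.≤-trans i≤t t≤L)) t ℕ.≤-refl)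
                          (CommutativeRing.*-identityʳ (seriesRing t) h t ℕ.≤-refl)

  sizeFactor-beyond : ∀ s → N < suc s → sizeFactor (suc s) ≈ one
  sizeFactor-beyond s N<s = ≈-trans (*-cong onePlus≈one geomInv≈one) (*-identityˡ one)
    where
    onePlus≈one : onePlus (suc s) ≈ one
    onePlus≈one t t≤N = onePlus-below (ℕ.≤-<-trans t≤N N<s)
    geomInv≈one : geomInv (suc s) ≈ one
    geomInv≈one t t≤N = geomInv-below s (ℕ.≤-<-trans t≤N N<s)

  factorsFrom≈prodUpTo : ∀ a → factorsFrom (suc a) ≈ prodUpTo (suc N) (λ i → sizeFactor (suc a ℕ.+ i))
  factorsFrom≈prodUpTo a = ≈-trans (*-cong (prodInf-≈ _ (λ j t t≤j → onePlus-below (s≤s (ℕ.≤-trans t≤j (ℕ.m≤n+m j a)))))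
                                    (prodInf-≈ _ (λ j t t≤j → geomInv-below (a ℕ.+ j) (s≤s (ℕ.≤-trans t≤j (ℕ.m≤n+m j a))))))
                            (prodUpTo-⊛ (suc N) _ _)

  factorsFrom-unfold : ∀ a → factorsFrom (suc a) ≈ sizeFactor (suc a) ⊛ factorsFrom (suc (suc a))
  factorsFrom-unfold a = begin
    factorsFrom (suc a)
      ≈⟨ factorsFrom≈prodUpTo a ⟩
    prodUpTo (suc N) (λ i → sizeFactor (suc a ℕ.+ i))
      ≈⟨ prodUpTo-unfoldˡ N _ ⟩
    sizeFactor (suc a ℕ.+ 0) ⊛ prodUpTo N (λ i → sizeFactor (suc a ℕ.+ suc i))
      ≈⟨ *-cong (≈-reflexive (cong (sizeFactor ∘ suc) (ℕ.+-identityʳ a)))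
                (prodUpTo-cong N (λ i → ≈-reflexive (cong (sizeFactor ∘ suc) (ℕ.+-suc a i)))) ⟩
    sizeFactor (suc a) ⊛ prodUpTo N (λ i → sizeFactor (suc (suc a) ℕ.+ i))
      ≈⟨ *-cong (≈-refl {sizeFactor (suc a)}) (≈-sym dropLast) ⟩
    sizeFactor (suc a) ⊛ prodUpTo (suc N) (λ i → sizeFactor (suc (suc a) ℕ.+ i))
      ≈⟨ *-cong (≈-refl {sizeFactor (suc a)}) (≈-sym (factorsFrom≈prodUpTo (suc a))) ⟩
    sizeFactor (suc a) ⊛ factorsFrom (suc (suc a)) ∎
    where
    F : ℕ → Series
    F i = sizeFactor (suc (suc a) ℕ.+ i)
    dropLast : prodUpTo (suc N) F ≈ prodUpTo N F
    dropLast = ≈-trans (*-cong (≈-refl {prodUpTo N F}) (sizeFactor-beyond (suc a ℕ.+ N) (s≤s (ℕ.m≤n+m N (suc a)))))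
                       (*-identityʳ (prodUpTo N F))

  factorsFrom-beyond : ∀ a → N < suc a → factorsFrom (suc a) ≈ one
  factorsFrom-beyond a N<a = ≈-trans (factorsFrom≈prodUpTo a)
    (prodUpTo-one (suc N) (λ i → sizeFactor-beyond (a ℕ.+ i) (ℕ.<-≤-trans N<a (s≤s (ℕ.m≤m+n a i)))))

  geometricIdentity : ∀ x y u v → u ≈ one ⊕ x ⊛ u → v ≈ one ⊕ y ⊛ v →
    u ⊛ ((one ⊕ y) ⊛ v) ⊕ x ⊛ v ≈ x ⊛ y ⊛ ((one ⊕ x) ⊛ u) ⊛ v ⊕ (one ⊕ x) ⊛ ((one ⊕ y) ⊛ v) ⊕ x ⊛ u
  geometricIdentity x y u v hu hv = begin
    u ⊛ ((one ⊕ y) ⊛ v) ⊕ x ⊛ v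
      ≈⟨ +-cong (*-cong hu ≈-refl) ≈-refl ⟩
    (one ⊕ x ⊛ u) ⊛ ((one ⊕ y) ⊛ v) ⊕ x ⊛ v
      ≈⟨ solve 4 (λ x y u v → (con 1 :+ x :* u) :* ((con 1 :+ y) :* v) :+ x :* v
                             := (con 1 :+ y) :* v :+ x :* v :+ x :* y :* u :* v :+ x :* u :* v) ≈-refl x y u v ⟩
    (one ⊕ y) ⊛ v ⊕ x ⊛ v ⊕ x ⊛ y ⊛ u ⊛ v ⊕ x ⊛ u ⊛ v
      ≈⟨ +-cong (≈-refl {(one ⊕ y) ⊛ v ⊕ x ⊛ v ⊕ x ⊛ y ⊛ u ⊛ v}) (*-cong (≈-refl {x ⊛ u}) hv) ⟩
    (one ⊕ y) ⊛ v ⊕ x ⊛ v ⊕ x ⊛ y ⊛ u ⊛ v ⊕ x ⊛ u ⊛ (one ⊕ y ⊛ v)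
      ≈⟨ solve 4 (λ x y u v → (con 1 :+ y) :* v :+ x :* v :+ x :* y :* u :* v :+ x :* u :* (con 1 :+ y :* v)
                             := (con 1 :+ y) :* v :+ x :* v :+ x :* u :+ x :* y :* u :* v :+ x :* y :* v :* u) ≈-refl x y u v ⟩
    (one ⊕ y) ⊛ v ⊕ x ⊛ v ⊕ x ⊛ u ⊕ x ⊛ y ⊛ u ⊛ v ⊕ x ⊛ y ⊛ v ⊛ u
      ≈⟨ +-cong (≈-refl {(one ⊕ y) ⊛ v ⊕ x ⊛ v ⊕ x ⊛ u ⊕ x ⊛ y ⊛ u ⊛ v}) (*-cong (≈-refl {x ⊛ y ⊛ v}) hu) ⟩
    (one ⊕ y) ⊛ v ⊕ x ⊛ v ⊕ x ⊛ u ⊕ x ⊛ y ⊛ u ⊛ v ⊕ x ⊛ y ⊛ v ⊛ (one ⊕ x ⊛ u)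
      ≈⟨ solve 4 (λ x y u v → (con 1 :+ y) :* v :+ x :* v :+ x :* u :+ x :* y :* u :* v :+ x :* y :* v :* (con 1 :+ x :* u)
                             := x :* y :* ((con 1 :+ x) :* u) :* v :+ (con 1 :+ x) :* ((con 1 :+ y) :* v) :+ x :* u) ≈-refl x y u v ⟩
    x ⊛ y ⊛ ((one ⊕ x) ⊛ u) ⊛ v ⊕ (one ⊕ x) ⊛ ((one ⊕ y) ⊛ v) ⊕ x ⊛ u ∎

  telescopeStep : ∀ C R P a x y u v → u ≈ one ⊕ x ⊛ u → v ≈ one ⊕ y ⊛ v →
    (C ⊕ R ⊕ a ⊛ twice P ⊛ u) ⊛ ((one ⊕ y) ⊛ v) ⊕ x ⊛ a ⊛ twice P ⊛ v ≈
    C ⊛ ((one ⊕ y) ⊛ v) ⊕ y ⊛ (x ⊛ a) ⊛ twice (P ⊛ ((one ⊕ x) ⊛ u)) ⊛ v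
      ⊕ (R ⊕ twice (P ⊛ (one ⊕ x)) ⊛ a) ⊛ ((one ⊕ y) ⊛ v) ⊕ x ⊛ a ⊛ twice P ⊛ u
  telescopeStep C R P a x y u v hu hv = begin
    (C ⊕ R ⊕ a ⊛ twice P ⊛ u) ⊛ ((one ⊕ y) ⊛ v) ⊕ x ⊛ a ⊛ twice P ⊛ v
      ≈⟨ solve 8 (λ C R P a x y u v →
                    (C :+ R :+ a :* (P :+ P) :* u) :* ((con 1 :+ y) :* v) :+ x :* a :* (P :+ P) :* v
                    := C :* ((con 1 :+ y) :* v) :+ R :* ((con 1 :+ y) :* v) :+ (P :+ P) :* a :* (u :* ((con 1 :+ y) :* v) :+ x :* v))
                 ≈-refl C R P a x y u v ⟩
    C ⊛ ((one ⊕ y) ⊛ v) ⊕ R ⊛ ((one ⊕ y) ⊛ v) ⊕ twice P ⊛ a ⊛ (u ⊛ ((one ⊕ y) ⊛ v) ⊕ x ⊛ v)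
      ≈⟨ +-cong (≈-refl {C ⊛ ((one ⊕ y) ⊛ v) ⊕ R ⊛ ((one ⊕ y) ⊛ v)}) (*-cong (≈-refl {twice P ⊛ a}) (geometricIdentity x y u v hu hv)) ⟩
    C ⊛ ((one ⊕ y) ⊛ v) ⊕ R ⊛ ((one ⊕ y) ⊛ v) ⊕ twice P ⊛ a ⊛ (x ⊛ y ⊛ ((one ⊕ x) ⊛ u) ⊛ v ⊕ (one ⊕ x) ⊛ ((one ⊕ y) ⊛ v) ⊕ x ⊛ u)
      ≈⟨ solve 8 (λ C R P a x y u v →
                    C :* ((con 1 :+ y) :* v) :+ R :* ((con 1 :+ y) :* v)
                      :+ (P :+ P) :* a :* (x :* y :* ((con 1 :+ x) :* u) :* v :+ (con 1 :+ x) :* ((con 1 :+ y) :* v) :+ x :* u)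
                    := C :* ((con 1 :+ y) :* v) :+ y :* (x :* a) :* (P :* ((con 1 :+ x) :* u) :+ P :* ((con 1 :+ x) :* u)) :* v
                      :+ (R :+ (P :* (con 1 :+ x) :+ P :* (con 1 :+ x)) :* a) :* ((con 1 :+ y) :* v) :+ x :* a :* (P :+ P) :* u)
                 ≈-refl C R P a x y u v ⟩
    C ⊛ ((one ⊕ y) ⊛ v) ⊕ y ⊛ (x ⊛ a) ⊛ twice (P ⊛ ((one ⊕ x) ⊛ u)) ⊛ v
      ⊕ (R ⊕ twice (P ⊛ (one ⊕ x)) ⊛ a) ⊛ ((one ⊕ y) ⊛ v) ⊕ x ⊛ a ⊛ twice P ⊛ u ∎

module Corollary (N k' : ℕ) where

  open Truncated N

  k : ℕ
  k = suc k'

  -- the summand of rhsCor28 k for the part size s = k + j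
  term : ℕ → Series
  term s = mono (k ℕ.* s) ⊛ negPochInf (s ℕ.+ 1) ⊛ invPochInf (s ℕ.+ 1)

  tail : ℕ → Series
  tail m = sumInf (λ j → term (m ℕ.+ j))

  prefactor : Series
  prefactor = overpartGF k' ⊛ onePlus k

  -- R_{d+k} = Σ_{k ≤ s < d+k} 2 prefactor q^{ks} ∏_{s < t ≤ d+k} sizeFactor t
  partialSum : ℕ → Series
  partialSum zero    = 0ₛ
  partialSum (suc d) = (partialSum d ⊕ twice prefactor ⊛ mono (k ℕ.* (d ℕ.+ k))) ⊛ sizeFactor (suc (d ℕ.+ k))

  excess : ℕ → Series
  excess m = mono (k ℕ.* m) ⊛ twice (overpartGF k') ⊛ geomInv k

  term-below : ∀ s {n} → n < s → term s n ≡ 0ℤ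
  term-below s {n} n<s = ⊛-vanishes n _ (invPochInf (s ℕ.+ 1)) (λ i i≤n →
    mono-⊛-below (k ℕ.* s) (negPochInf (s ℕ.+ 1)) (ℕ.<-≤-trans (ℕ.≤-<-trans i≤n n<s) (ℕ.m≤n*m s k)))

  term≈ : ∀ s → term s ≈ mono (k ℕ.* s) ⊛ factorsFrom (suc s)
  term≈ s = ≈-trans (*-assoc (mono (k ℕ.* s)) _ _)
                     (≈-reflexive (cong (λ a → mono (k ℕ.* s) ⊛ factorsFrom a) (ℕ.+-comm s 1)))

  tail-unfold : ∀ m → tail m ≈ term m ⊕ tail (suc m)
  tail-unfold m = ≗⇒≈ N (λ n →
    trans (sumInf-unfold (λ j → term (m ℕ.+ j)) (λ j n<j → term-below (m ℕ.+ j) (ℕ.<-≤-trans n<j (ℕ.m≤n+m j m))) n)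
          (cong₂ _+_ (cong (λ s → term s n) (ℕ.+-identityʳ m))
                     (sumInf-cong (λ j n → cong (λ s → term s n) (ℕ.+-suc m j)) n)))

  tail-beyond : ∀ m → N < m → tail m ≈ 0ₛ
  tail-beyond m N<m i i≤N = sumInf-vanishes (λ j → term (m ℕ.+ j)) i (λ j →
    term-below (m ℕ.+ j) (ℕ.<-≤-trans (ℕ.≤-<-trans i≤N N<m) (ℕ.m≤m+n m j)))

  prefactor-≈ : negPoch 1 k ⊛ invPoch 1 (k ∸ 1) ≈ prefactor
  prefactor-≈ = begin
    negPoch 1 k' ⊛ onePlus k ⊛ invPoch 1 k'
      ≈⟨ solve 3 (λ a b c → a :* b :* c := a :* c :* b) ≈-refl (negPoch 1 k') (onePlus k) (invPoch 1 k') ⟩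
    negPoch 1 k' ⊛ invPoch 1 k' ⊛ onePlus k
      ≈⟨ *-cong (prodUpTo-⊛ k' _ _) (≈-refl {onePlus k}) ⟩
    prefactor ∎

  rhs-decomposition : ∀ d → rhsCor28 k ≈ partialSum d ⊛ factorsFrom (suc (d ℕ.+ k)) ⊕ twice prefactor ⊛ tail (d ℕ.+ k)
  rhs-decomposition zero = begin
    rhsCor28 k
      ≈⟨ ≗⇒≈ N (scale-2 (negPoch 1 k ⊛ invPoch 1 (k ∸ 1) ⊛ tail k)) ⟩
    twice (negPoch 1 k ⊛ invPoch 1 (k ∸ 1) ⊛ tail k)
      ≈⟨ twice-cong (*-cong prefactor-≈ (≈-refl {tail k})) ⟩
    twice (prefactor ⊛ tail k)
      ≈⟨ solve 3 (λ f x t → x :* t :+ x :* t := con 0 :* f :+ (x :+ x) :* t) ≈-refl (factorsFrom (suc k)) prefactor (tail k) ⟩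
    0ₛ ⊛ factorsFrom (suc k) ⊕ twice prefactor ⊛ tail k ∎
  rhs-decomposition (suc d) = begin
    rhsCor28 k
      ≈⟨ rhs-decomposition d ⟩
    S ⊛ factorsFrom (suc m) ⊕ W ⊛ tail m
      ≈⟨ +-cong (≈-refl {S ⊛ factorsFrom (suc m)}) (*-cong (≈-refl {W}) (≈-trans (tail-unfold m) (+-cong (term≈ m) ≈-refl))) ⟩
    S ⊛ factorsFrom (suc m) ⊕ W ⊛ (a ⊛ factorsFrom (suc m) ⊕ tail (suc m))
      ≈⟨ +-cong (*-cong (≈-refl {S}) (factorsFrom-unfold m)) (*-cong (≈-refl {W}) (+-cong (*-cong (≈-refl {a}) (factorsFrom-unfold m)) ≈-refl)) ⟩
    S ⊛ (G ⊛ F) ⊕ W ⊛ (a ⊛ (G ⊛ F) ⊕ tail (suc m))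
      ≈⟨ solve 6 (λ S W a G F t → S :* (G :* F) :+ W :* (a :* (G :* F) :+ t) := (S :+ W :* a) :* G :* F :+ W :* t)
                 ≈-refl S W a G F (tail (suc m)) ⟩
    partialSum (suc d) ⊛ F ⊕ W ⊛ tail (suc m) ∎
    where
    m = d ℕ.+ k
    S = partialSum d
    W = twice prefactor
    a = mono (k ℕ.* m)
    G = sizeFactor (suc m)
    F = factorsFrom (suc (suc m))

  difference-invariant : ∀ d → condGF k' (d ℕ.+ k) ≈ condGF k (d ℕ.+ k) ⊕ partialSum d ⊕ excess (d ℕ.+ k)
  difference-invariant zero = begin
    condGF k' k
      ≈⟨ condGF-suc-above k' k' ℕ.≤-refl ⟩
    condGF k' k' ⊛ sizeFactor k ⊕ mono (k ℕ.* k) ⊛ twice (atMostGF k' k') ⊛ geomInv k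
      ≈⟨ +-cong (*-cong (condGF-small k' k' ℕ.≤-refl) ≈-refl)
                (*-cong (*-cong (≈-refl {mono (k ℕ.* k)}) (twice-cong (atMostGF-small k' k' ℕ.≤-refl))) (≈-refl {geomInv k})) ⟩
    0ₛ ⊛ sizeFactor k ⊕ excess k
      ≈⟨ solve 2 (λ g e → con 0 :* g :+ e := con 0 :+ con 0 :+ e) ≈-refl (sizeFactor k) (excess k) ⟩
    0ₛ ⊕ 0ₛ ⊕ excess k
      ≈⟨ +-cong (+-cong (≈-sym (condGF-small k k ℕ.≤-refl)) ≈-refl) ≈-refl ⟩
    condGF k k ⊕ partialSum 0 ⊕ excess k ∎
  difference-invariant (suc d) = begin
    condGF k' (suc m)
      ≈⟨ condGF-suc-above k' m (ℕ.m≤n⇒m≤1+n k≤m) ⟩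
    condGF k' m ⊛ sizeFactor (suc m) ⊕ mono (k ℕ.* suc m) ⊛ twice (atMostGF k' m) ⊛ v
      ≈⟨ +-cong (*-cong (difference-invariant d) ≈-refl)
                (*-cong (*-cong q^k[m+1] (twice-cong (atMostGF-large k' m (ℕ.<⇒≤ k≤m)))) (≈-refl {v})) ⟩
    (C ⊕ partialSum d ⊕ a ⊛ twice P ⊛ u) ⊛ sizeFactor (suc m) ⊕ x ⊛ a ⊛ twice P ⊛ v
      ≈⟨ telescopeStep C (partialSum d) P a x y u v (geomInv-unfold-≈ k') (geomInv-unfold-≈ m) ⟩
    C ⊛ sizeFactor (suc m) ⊕ y ⊛ (x ⊛ a) ⊛ twice (P ⊛ sizeFactor k) ⊛ v ⊕ partialSum (suc d) ⊕ x ⊛ a ⊛ twice P ⊛ u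
      ≈⟨ +-cong (+-cong (≈-sym condGF-k-suc) (≈-refl {partialSum (suc d)}))
                (≈-sym (*-cong (*-cong q^k[m+1] (≈-refl {twice P})) (≈-refl {u}))) ⟩
    condGF k (suc m) ⊕ partialSum (suc d) ⊕ excess (suc m) ∎
    where
    m = d ℕ.+ k
    k≤m : k ≤ m
    k≤m = ℕ.m≤n+m k d
    C = condGF k m
    P = overpartGF k'
    a = mono (k ℕ.* m)
    x = mono k
    y = mono (suc m)
    u = geomInv k
    v = geomInv (suc m)
    q^k[m+1] : mono (k ℕ.* suc m) ≈ x ⊛ a
    q^k[m+1] = ≈-trans (≈-reflexive (cong mono (ℕ.*-suc k m))) (mono-+-≈ k (k ℕ.* m))
    condGF-k-suc : condGF k (suc m) ≈ C ⊛ sizeFactor (suc m) ⊕ y ⊛ (x ⊛ a) ⊛ twice (P ⊛ sizeFactor k) ⊛ v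
    condGF-k-suc = ≈-trans (condGF-suc-above k m (s≤s k≤m))
      (+-cong (≈-refl {C ⊛ sizeFactor (suc m)})
              (*-cong (*-cong (≈-trans (mono-+-≈ (suc m) (k ℕ.* suc m)) (*-cong (≈-refl {y}) q^k[m+1]))
                              (twice-cong (atMostGF-large k m k≤m)))
                      (≈-refl {v})))

  difference : condGF k' (N ℕ.+ k) ≈ condGF k (N ℕ.+ k) ⊕ rhsCor28 k
  difference = begin
    condGF k' M                            ≈⟨ difference-invariant N ⟩
    condGF k M ⊕ partialSum N ⊕ excess M   ≈⟨ +-cong (+-cong (≈-refl {condGF k M}) (≈-sym rhs≈partialSum)) excess≈0 ⟩
    condGF k M ⊕ rhsCor28 k ⊕ 0ₛ           ≈⟨ +-identityʳ (condGF k M ⊕ rhsCor28 k) ⟩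
    condGF k M ⊕ rhsCor28 k                ∎
    where
    M = N ℕ.+ k
    N<M : N < M
    N<M = ℕ.m<m+n N (s≤s z≤n)
    excess≈0 : excess M ≈ 0ₛ
    excess≈0 = begin
      mono (k ℕ.* M) ⊛ twice P ⊛ geomInv k  ≈⟨ *-cong (*-cong (mono-beyond (ℕ.<-≤-trans N<M (ℕ.m≤n*m M k))) (≈-refl {twice P})) ≈-refl ⟩
      0ₛ ⊛ twice P ⊛ geomInv k              ≈⟨ solve 2 (λ p u → con 0 :* p :* u := con 0) ≈-refl (twice P) (geomInv k) ⟩
      0ₛ                                    ∎
      where P = overpartGF k'
    rhs≈partialSum : rhsCor28 k ≈ partialSum N
    rhs≈partialSum = begin
      rhsCor28 k
        ≈⟨ rhs-decomposition N ⟩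
      partialSum N ⊛ factorsFrom (suc M) ⊕ twice prefactor ⊛ tail M
        ≈⟨ +-cong (*-cong (≈-refl {partialSum N}) (factorsFrom-beyond M (ℕ.m<n⇒m<1+n N<M)))
                  (*-cong (≈-refl {twice prefactor}) (tail-beyond M N<M)) ⟩
      partialSum N ⊛ one ⊕ twice prefactor ⊛ 0ₛ
        ≈⟨ solve 2 (λ r w → r :* con 1 :+ w :* con 0 := r) ≈-refl (partialSum N) (twice prefactor) ⟩
      partialSum N ∎

corollary2p8 : (k : ℕ) → 1 ≤ k → (n : ℕ) → 1 ≤ n →
    (+ Mbar (k ∸ 1) n) - (+ Mbar k n) ≡ rhsCor28 k n
corollary2p8 zero    () n _
corollary2p8 (suc k') _  n _ = begin
  + Mbar k' n - + Mbar k n                     ≡⟨ cong₂ _-_ (Mbar≡condGF k' M n n≤M) (Mbar≡condGF k M n n≤M) ⟩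
  condGF k' M n - condGF k M n                 ≡⟨ cong (_- condGF k M n) (difference n ℕ.≤-refl) ⟩
  condGF k M n + rhsCor28 k n - condGF k M n   ≡⟨ cancel (condGF k M n) (rhsCor28 k n) ⟩
  rhsCor28 k n                                 ∎
  where
  open ≡-Reasoning
  open Corollary n k'
  M = n ℕ.+ k
  n≤M : n ≤ M
  n≤M = ℕ.m≤m+n n k
  cancel : ∀ a b → a + b - a ≡ b
  cancel = solve-∀
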